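{- Let $G$ be a finite simple graph on $n$ vertices with minimum degree $\delta(G)$. If $\delta(G) = (n+1)/2$, then $\theta_e(G) \leq \frac{n^2}{4} - \frac{n}{2} + \frac14$. If $\delta(G) = n/2 + 1$, then $\theta_e(G) \leq \frac{n^2}{4} - n + 2$.
   Context: All graphs are finite, simple and undirected. A clique is a set of vertices inducing a complete subgraph. An edge clique cover of $G$ is a set of cliques of $G$ such that every edge of $G$ has both endpoints in some clique of the set; $\theta_e(G)$ is the minimum number of cliques in an edge clique cover of $G$. -}

module Defs where

open import Data.Nat using (ℕ; _≤_)
open import Data.Fin using (Fin)
open import Data.Fin.Subset using (Subset; _∈_; ∣_∣)
open import Data.Fin.Subset.Properties using ()
open import Data.List using (List; length)
open import Data.List.Relation.Unary.Any using (Any)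
open import Data.Product using (Σ; ∃; _×_; _,_)
open import Relation.Nullary using (¬_; Dec)
open import Relation.Binary.PropositionalEquality using (_≡_)

record Graph (n : ℕ) : Set₁ where
  field
    Adj    : Fin n → Fin n → Set
    adj?   : ∀ u v → Dec (Adj u v)
    irrefl : ∀ u → ¬ Adj u u
    sym    : ∀ {u v} → Adj u v → Adj v u

open Graph public

open import Data.Vec using (tabulate)
open import Relation.Nullary.Decidable using (does)

nbhd : ∀ {n} (G : Graph n) → Fin n → Subset n
nbhd G v = tabulate (λ u → does (adj? G v u))

degree : ∀ {n} (G : Graph n) → Fin n → ℕ
degree G v = ∣ nbhd G v ∣

MinDegree : ∀ {n} → Graph n → ℕ → Set
MinDegree G d = (∀ v → d ≤ degree G v) × ∃ (λ v → degree G v ≡ d)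

IsClique : ∀ {n} → Graph n → Subset n → Set
IsClique G C = ∀ u v → u ∈ C → v ∈ C → ¬ (u ≡ v) → Adj G u v

IsEdgeCliqueCover : ∀ {n} → Graph n → List (Subset n) → Set
IsEdgeCliqueCover G 𝒞 =
  (Data.List.Relation.Unary.All.All (IsClique G) 𝒞) ×
  (∀ u v → Adj G u v → Any (λ C → u ∈ C × v ∈ C) 𝒞)
  where import Data.List.Relation.Unary.All

θe≤ : ∀ {n} → Graph n → ℕ → Set
θe≤ G k = Σ (List _) (λ 𝒞 → IsEdgeCliqueCover G 𝒞 × length 𝒞 ≤ k)

-- Matchings under an Ore-type condition: if deg u + deg w ≥ n + |X| for all u, w, the vertices
-- outside X can be perfectly matched greedily.  Two unmatched vertices u, w without unmatched
-- neighbours together have more than 2|M| neighbours among the 2|M| matched vertices, so some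
-- matching edge xy has u ~ x and w ~ y, and trading xy for ux, wy matches two more vertices.
-- For δ = (n+1)/2 this matches G − v, and v, having more neighbours than there are matching edges,
-- sees both ends of one of them: a triangle.  For δ = n/2 + 1 there is a perfect matching, and the
-- ends x, y of one of its edges each see both ends of another matching edge: a K₄ or two triangles.
-- A partition of V into m edges followed by cliques Q₁, …, Q_r gives an edge clique cover made of
-- the parts and, for every vertex x and every later part P, the clique {x} ∪ (N(x) ∩ P).  Listing the
-- edges first it has m(m + 2r) cliques plus those covering the Q's: k² for n = 2k + 1 and at most
-- k² + 1 for n = 2k + 2.

module Submission where

open import Defs
open import Data.Nat using (ℕ; _+_; _*_; _≤_)
open import Data.Product using (_×_; Σ)
open import Data.List using (List; length)
open import Data.Fin.Subset using (Subset)
open import Relation.Binary.PropositionalEquality using (_≡_)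

open import Function using (_∘_)
open import Data.Empty using (⊥-elim)
open import Data.Nat using (zero; suc; _<_; z≤n; s≤s)
open import Data.Nat.Properties
open import Data.Nat.Tactic.RingSolver using (solve-∀)
open import Data.Product as Product using (_,_; proj₁; proj₂; ∃; ∃₂)
open import Data.Sum as Sum using (_⊎_; inj₁; inj₂)
open import Data.Fin as Fin using (Fin)
open import Data.Fin.Subset using (⁅_⁆; _∪_; _∩_; ⊥; _⊆_; inside; outside; ∣_∣) renaming (_∈_ to _∈ₛ_)
open import Data.Fin.Subset.Properties
  using (x∈p∪q⁺; x∈p∪q⁻; x∈⁅x⁆; x∈⁅y⁆⇒x≡y; ∉⊥; p⊆q⇒∣p∣≤∣q∣; ∣p∣≤∣x∷p∣; ∣⁅x⁆∣≡1; ∣⊥∣≡0; x∈p∩q⁺; x∈p∩q⁻)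
open import Data.Vec using (_∷_; [])
open import Data.Vec.Properties using (lookup∘tabulate; []=⇒lookup; lookup⇒[]=)
open import Data.List using ([]; _∷_; _++_; map; filter; concatMap; allFin)
import Data.List as List
open import Data.List.Properties using (++-identityʳ; length-++; length-map; length-filter; filter-++; length-removeAt′; length-tabulate)
open import Data.List.Membership.Propositional using (_∈_; lose)
open import Data.List.Membership.Propositional.Properties using (∈-filter⁺; ∈-++⁺ˡ; ∈-++⁺ʳ; ∈-++⁻; ∈-allFin)
open import Data.List.Relation.Unary.Any as Any using (Any; here; there; _─_; any?)
open import Data.List.Relation.Unary.Any.Properties as Any using (lookup-result)
open import Data.List.Relation.Unary.All as All using (All; []; _∷_)
import Data.List.Relation.Unary.All.Properties as All
open import Data.List.Relation.Unary.AllPairs using (AllPairs; []; _∷_)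
open import Relation.Nullary using (¬_; Dec; yes; no; does; contradiction)
open import Relation.Nullary.Decidable using (dec-true; _×-dec_; _⊎-dec_)
open import Relation.Unary using (Pred)
open import Relation.Binary.PropositionalEquality as ≡ using (refl; _≢_; cong; cong₂; subst; trans; module ≡-Reasoning)

∣p∪q∣≤∣p∣+∣q∣ : ∀ {m} (p q : Subset m) → ∣ p ∪ q ∣ ≤ ∣ p ∣ + ∣ q ∣
∣p∪q∣≤∣p∣+∣q∣ []            []            = z≤n
∣p∪q∣≤∣p∣+∣q∣ (inside ∷ p)  (s ∷ q)       =
  s≤s (≤-trans (∣p∪q∣≤∣p∣+∣q∣ p q) (+-monoʳ-≤ ∣ p ∣ (∣p∣≤∣x∷p∣ s q)))
∣p∪q∣≤∣p∣+∣q∣ (outside ∷ p) (inside ∷ q)  =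
  ≤-trans (s≤s (∣p∪q∣≤∣p∣+∣q∣ p q)) (≤-reflexive (≡.sym (+-suc ∣ p ∣ ∣ q ∣)))
∣p∪q∣≤∣p∣+∣q∣ (outside ∷ p) (outside ∷ q) = ∣p∪q∣≤∣p∣+∣q∣ p q

module _ {m : ℕ} where

  fromList : List (Fin m) → Subset m
  fromList []       = ⊥
  fromList (x ∷ xs) = ⁅ x ⁆ ∪ fromList xs

  ∈-fromList⁺ : ∀ {x xs} → x ∈ xs → x ∈ₛ fromList xs
  ∈-fromList⁺ {x} (here refl) = x∈p∪q⁺ (inj₁ (x∈⁅x⁆ x))
  ∈-fromList⁺     (there x∈)  = x∈p∪q⁺ (inj₂ (∈-fromList⁺ x∈))

  ∈-fromList⁻ : ∀ {x} xs → x ∈ₛ fromList xs → x ∈ xs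
  ∈-fromList⁻ []       x∈ = ⊥-elim (∉⊥ x∈)
  ∈-fromList⁻ (y ∷ xs) x∈ with x∈p∪q⁻ ⁅ y ⁆ (fromList xs) x∈
  ... | inj₁ x∈⁅y⁆ = here (x∈⁅y⁆⇒x≡y y x∈⁅y⁆)
  ... | inj₂ x∈xs  = there (∈-fromList⁻ xs x∈xs)

  ∣fromList∣≤length : ∀ xs → ∣ fromList xs ∣ ≤ length xs
  ∣fromList∣≤length []       = ≤-reflexive (∣⊥∣≡0 m)
  ∣fromList∣≤length (x ∷ xs) = ≤-trans (∣p∪q∣≤∣p∣+∣q∣ ⁅ x ⁆ (fromList xs))
    (≤-trans (≤-reflexive (cong (_+ ∣ fromList xs ∣) (∣⁅x⁆∣≡1 x))) (s≤s (∣fromList∣≤length xs)))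

module _ {a p q} {A : Set a} {P : Pred A p} {Q : Pred A q} where

  Any-─⁻ : ∀ {xs} (i : Any P xs) → Any Q xs → Q (Any.lookup i) ⊎ Any Q (xs ─ i)
  Any-─⁻ (here _)  (here qx)  = inj₁ qx
  Any-─⁻ (here _)  (there qs) = inj₂ qs
  Any-─⁻ (there _) (here qx)  = inj₂ (here qx)
  Any-─⁻ (there i) (there qs) = Sum.map₂ there (Any-─⁻ i qs)

  Any-─⁺ : ∀ {xs} (i : Any P xs) (j : Any Q xs) → Any.index i ≢ Any.index j → Any Q (xs ─ i)
  Any-─⁺ (here _)  (here _)   i≢j = ⊥-elim (i≢j refl)
  Any-─⁺ (here _)  (there qs) _   = qs
  Any-─⁺ (there _) (here qx)  _   = here qx
  Any-─⁺ (there i) (there qs) i≢j = there (Any-─⁺ i qs (i≢j ∘ cong Fin.suc))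

module _ {a} {A : Set a} where

  pair : A × A → List A
  pair (x , y) = x ∷ y ∷ []

  endpoints : List (A × A) → List A
  endpoints = concatMap pair

  ∈-endpoints⁻ : ∀ {z} M → z ∈ endpoints M → Any (z ∈_) (map pair M)
  ∈-endpoints⁻ M = Any.concat⁻ (map pair M)

  ∈-endpoints-─ : ∀ {p} {P : Pred (A × A) p} {z M} (i : Any P M) → z ∈ endpoints M →
                  z ∈ pair (Any.lookup i) ⊎ z ∈ endpoints (M ─ i)
  ∈-endpoints-─ {M = M} i z∈ =
    Sum.map₂ (Any.concat⁺ ∘ Any.map⁺) (Any-─⁻ i (Any.map⁻ (∈-endpoints⁻ M z∈)))

indicator : ∀ {p} {P : Set p} → Dec P → ℕ
indicator (yes _) = 1
indicator (no _)  = 0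

indicator-+-≤1 : ∀ {p q} {P : Set p} {Q : Set q} (P? : Dec P) (Q? : Dec Q) →
                 ¬ (P × Q) → indicator P? + indicator Q? ≤ 1
indicator-+-≤1 (yes p) (yes q) ¬pq = ⊥-elim (¬pq (p , q))
indicator-+-≤1 (yes _) (no _)  _   = ≤-refl
indicator-+-≤1 (no _)  (yes _) _   = ≤-refl
indicator-+-≤1 (no _)  (no _)  _   = z≤n

2*[1+m]+j≡2*m+[2+j] : ∀ m j → 2 * suc m + j ≡ 2 * m + (2 + j)
2*[1+m]+j≡2*m+[2+j] = solve-∀

crossing-count : ∀ m j x cu cw → (2 * m + (2 + j)) + 2 * x ≤ (cu + x) + (cw + x) → 2 * m < cu + cw
crossing-count m j x cu cw h = <-≤-trans (m<m+n (2 * m) (s≤s z≤n))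
  (+-cancelʳ-≤ (2 * x) (2 * m + (2 + j)) (cu + cw) (≤-trans h (≤-reflexive (regroup cu cw x))))
  where
  regroup : ∀ cu cw x → (cu + x) + (cw + x) ≡ (cu + cw) + 2 * x
  regroup = solve-∀

m*[m+2]+1≡[1+m]*[1+m] : ∀ m → m * (m + 2 * 1) + 1 ≡ suc m * suc m
m*[m+2]+1≡[1+m]*[1+m] = solve-∀

m*[m+4]+5≡1+[2+m]*[2+m] : ∀ m → m * (m + 2 * 2) + 5 ≡ suc (suc (suc m) * suc (suc m))
m*[m+4]+5≡1+[2+m]*[2+m] = solve-∀

k+k+2≡[1+k]+[1+k] : ∀ k → (k + k) + 2 ≡ suc k + suc k
k+k+2≡[1+k]+[1+k] = solve-∀

module _ {n : ℕ} (G : Graph n) where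

  ∈-nbhd⁺ : ∀ {u v} → Adj G u v → v ∈ₛ nbhd G u
  ∈-nbhd⁺ {u} {v} uv =
    lookup⇒[]= v _ (trans (lookup∘tabulate (does ∘ adj? G u) v) (dec-true (adj? G u v) uv))

  ∈-nbhd⁻ : ∀ {u v} → v ∈ₛ nbhd G u → Adj G u v
  ∈-nbhd⁻ {u} {v} v∈ = adj-of (adj? G u v)
    (trans (≡.sym (lookup∘tabulate (does ∘ adj? G u) v)) ([]=⇒lookup v∈))
    where
    adj-of : (uv? : Dec (Adj G u v)) → does uv? ≡ inside → Adj G u v
    adj-of (yes uv) _ = uv

  adjCount : Fin n → List (Fin n) → ℕ
  adjCount u xs = length (filter (adj? G u) xs)

  adjCount-∷ : ∀ u x xs → adjCount u (x ∷ xs) ≡ indicator (adj? G u x) + adjCount u xs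
  adjCount-∷ u x xs with adj? G u x
  ... | yes _ = refl
  ... | no _  = refl

  adjCount-++ : ∀ u xs ys → adjCount u (xs ++ ys) ≡ adjCount u xs + adjCount u ys
  adjCount-++ u xs ys =
    trans (cong length (filter-++ (adj? G u) xs ys)) (length-++ (filter (adj? G u) xs))

  degree≤adjCount : ∀ u xs → (∀ {v} → Adj G u v → v ∈ xs) → degree G u ≤ adjCount u xs
  degree≤adjCount u xs nbrs =
    ≤-trans (p⊆q⇒∣p∣≤∣q∣ nbhd⊆) (∣fromList∣≤length (filter (adj? G u) xs))
    where
    nbhd⊆ : nbhd G u ⊆ fromList (filter (adj? G u) xs)
    nbhd⊆ v∈ = ∈-fromList⁺ (∈-filter⁺ (adj? G u) (nbrs (∈-nbhd⁻ v∈)) (∈-nbhd⁻ v∈))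

  degree≤adjCount+length : ∀ u xs ys → (∀ {v} → Adj G u v → v ∈ xs ++ ys) →
                           degree G u ≤ adjCount u xs + length ys
  degree≤adjCount+length u xs ys nbrs = begin
    degree G u                          ≤⟨ degree≤adjCount u (xs ++ ys) nbrs ⟩
    adjCount u (xs ++ ys)               ≡⟨ adjCount-++ u xs ys ⟩
    adjCount u xs + adjCount u ys       ≤⟨ +-monoʳ-≤ (adjCount u xs) (length-filter (adj? G u) ys) ⟩
    adjCount u xs + length ys           ∎
    where open ≤-Reasoning

  allPairs⇒adj : ∀ {xs u v} → AllPairs (Adj G) xs → u ∈ xs → v ∈ xs → u ≢ v → Adj G u v
  allPairs⇒adj (_  ∷ _)  (here refl) (here refl) u≢v = ⊥-elim (u≢v refl)
  allPairs⇒adj (hd ∷ _)  (here refl) (there v∈)  _   = All.lookup hd v∈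
  allPairs⇒adj (hd ∷ _)  (there u∈)  (here refl) _   = sym G (All.lookup hd u∈)
  allPairs⇒adj (_  ∷ tl) (there u∈)  (there v∈)  u≢v = allPairs⇒adj tl u∈ v∈ u≢v

  allPairs⇒isClique : ∀ {xs} → AllPairs (Adj G) xs → IsClique G (fromList xs)
  allPairs⇒isClique {xs} ps u v u∈ v∈ = allPairs⇒adj ps (∈-fromList⁻ xs u∈) (∈-fromList⁻ xs v∈)

  Covers : Fin n → Fin n → Subset n → Set
  Covers u v C = u ∈ₛ C × v ∈ₛ C

  apex : Fin n → Subset n → Subset n
  apex u C = ⁅ u ⁆ ∪ (nbhd G u ∩ C)

  apex-isClique : ∀ u {C} → IsClique G C → IsClique G (apex u C)
  apex-isClique u {C} isC v w v∈ w∈ v≢w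
    with x∈p∪q⁻ ⁅ u ⁆ (nbhd G u ∩ C) v∈ | x∈p∪q⁻ ⁅ u ⁆ (nbhd G u ∩ C) w∈
  ... | inj₁ v≡u | inj₁ w≡u = ⊥-elim (v≢w (trans (x∈⁅y⁆⇒x≡y u v≡u) (≡.sym (x∈⁅y⁆⇒x≡y u w≡u))))
  ... | inj₁ v≡u | inj₂ w∈N rewrite x∈⁅y⁆⇒x≡y u v≡u = ∈-nbhd⁻ (proj₁ (x∈p∩q⁻ _ _ w∈N))
  ... | inj₂ v∈N | inj₁ w≡u rewrite x∈⁅y⁆⇒x≡y u w≡u = sym G (∈-nbhd⁻ (proj₁ (x∈p∩q⁻ _ _ v∈N)))
  ... | inj₂ v∈N | inj₂ w∈N = isC v w (proj₂ (x∈p∩q⁻ _ _ v∈N)) (proj₂ (x∈p∩q⁻ _ _ w∈N)) v≢w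

  apex-covers : ∀ {u v C} → v ∈ₛ C → Adj G u v → Covers u v (apex u C)
  apex-covers {u} v∈C uv = x∈p∪q⁺ (inj₁ (x∈⁅x⁆ u)) , x∈p∪q⁺ (inj₂ (x∈p∩q⁺ (∈-nbhd⁺ uv , v∈C)))

  links : List (Fin n) → List (List (Fin n)) → List (Subset n)
  links []      Qs = []
  links (x ∷ P) Qs = map (apex x ∘ fromList) Qs ++ links P Qs

  cliqueCover : List (List (Fin n)) → List (Subset n)
  cliqueCover []       = []
  cliqueCover (P ∷ Ps) = fromList P ∷ links P Ps ++ cliqueCover Ps

  links-isClique : ∀ P {Qs} → All (AllPairs (Adj G)) Qs → All (IsClique G) (links P Qs)
  links-isClique []      _   = []
  links-isClique (x ∷ P) cls =
    All.++⁺ (All.map⁺ (All.map (apex-isClique x ∘ allPairs⇒isClique) cls)) (links-isClique P cls)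

  links-covers : ∀ P Qs {u v} → u ∈ P → Any (v ∈_) Qs → Adj G u v → Any (Covers u v) (links P Qs)
  links-covers (x ∷ P) Qs (here refl) v∈ uv =
    Any.++⁺ˡ (Any.map⁺ (Any.map (λ v∈Q → apex-covers (∈-fromList⁺ v∈Q) uv) v∈))
  links-covers (x ∷ P) Qs (there u∈) v∈ uv = Any.++⁺ʳ _ (links-covers P Qs u∈ v∈ uv)

  cliqueCover-isClique : ∀ {Ps} → All (AllPairs (Adj G)) Ps → All (IsClique G) (cliqueCover Ps)
  cliqueCover-isClique []                  = []
  cliqueCover-isClique {P ∷ _} (cl ∷ cls) =
    allPairs⇒isClique cl ∷ All.++⁺ (links-isClique P cls) (cliqueCover-isClique cls)

  cliqueCover-covers : ∀ Ps {u v} → Any (u ∈_) Ps → Any (v ∈_) Ps → Adj G u v →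
                       Any (Covers u v) (cliqueCover Ps)
  cliqueCover-covers (P ∷ Ps) (here u∈)  (here v∈)  _  = here (∈-fromList⁺ u∈ , ∈-fromList⁺ v∈)
  cliqueCover-covers (P ∷ Ps) (here u∈)  (there v∈) uv = there (Any.++⁺ˡ (links-covers P Ps u∈ v∈ uv))
  cliqueCover-covers (P ∷ Ps) (there u∈) (here v∈)  uv =
    there (Any.++⁺ˡ (Any.map (λ (v∈C , u∈C) → u∈C , v∈C) (links-covers P Ps v∈ u∈ (sym G uv))))
  cliqueCover-covers (P ∷ Ps) (there u∈) (there v∈) uv =
    there (Any.++⁺ʳ (links P Ps) (cliqueCover-covers Ps u∈ v∈ uv))

  cliqueCover-isECC : ∀ Ps → All (AllPairs (Adj G)) Ps → (∀ v → Any (v ∈_) Ps) →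
                      IsEdgeCliqueCover G (cliqueCover Ps)
  cliqueCover-isECC Ps cls cov =
    cliqueCover-isClique cls , λ u v uv → cliqueCover-covers Ps (cov u) (cov v) uv

  length-links : ∀ P Qs → length (links P Qs) ≡ length P * length Qs
  length-links []      Qs = refl
  length-links (x ∷ P) Qs = begin
    length (map (apex x ∘ fromList) Qs ++ links P Qs)       ≡⟨ length-++ (map (apex x ∘ fromList) Qs) ⟩
    length (map (apex x ∘ fromList) Qs) + length (links P Qs) ≡⟨ cong₂ _+_ (length-map _ Qs) (length-links P Qs) ⟩
    length Qs + length P * length Qs                          ∎
    where open ≡-Reasoning

  Edge : Fin n × Fin n → Set
  Edge (x , y) = Adj G x y

  edge⇒allPairs : ∀ {e} → Edge e → AllPairs (Adj G) (pair e)
  edge⇒allPairs xy = (xy ∷ []) ∷ [] ∷ []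

  length-cliqueCover-matching : ∀ M Qs →
    length (cliqueCover (map pair M ++ Qs)) ≡ length M * (length M + 2 * length Qs) + length (cliqueCover Qs)
  length-cliqueCover-matching []      Qs = refl
  length-cliqueCover-matching (e ∷ M) Qs = begin
    suc (length (links (pair e) R ++ cliqueCover R))           ≡⟨ cong suc (length-++ (links (pair e) R)) ⟩
    suc (length (links (pair e) R) + length (cliqueCover R))   ≡⟨ cong suc (cong₂ _+_ (length-links (pair e) R)
                                                                    (length-cliqueCover-matching M Qs)) ⟩
    suc (2 * length R + (m * (m + 2 * q) + c))                 ≡⟨ cong (λ r → suc (2 * r + (m * (m + 2 * q) + c)))
                                                                    (trans (length-++ (map pair M)) (cong (_+ q) (length-map pair M))) ⟩
    suc (2 * (m + q) + (m * (m + 2 * q) + c))                  ≡⟨ square-step m q c ⟩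
    suc m * (suc m + 2 * q) + c                                ∎
    where
    open ≡-Reasoning
    R = map pair M ++ Qs
    m = length M
    q = length Qs
    c = length (cliqueCover Qs)
    square-step : ∀ m q c → suc (2 * (m + q) + (m * (m + 2 * q) + c)) ≡ suc m * (suc m + 2 * q) + c
    square-step = solve-∀

  length-cliqueCover-singleton : ∀ P → length (cliqueCover (P ∷ [])) ≡ 1
  length-cliqueCover-singleton P = cong suc (begin
    length (links P [] ++ []) ≡⟨ cong length (++-identityʳ (links P [])) ⟩
    length (links P [])       ≡⟨ length-links P [] ⟩
    length P * 0              ≡⟨ *-zeroʳ (length P) ⟩
    0                         ∎)
    where open ≡-Reasoning

  CoversVertices : List (Fin n × Fin n) → List (List (Fin n)) → Set
  CoversVertices M Qs = ∀ z → z ∈ endpoints M ⊎ Any (z ∈_) Qs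

  θe≤-matching : ∀ M Qs → All Edge M → All (AllPairs (Adj G)) Qs → CoversVertices M Qs →
                 θe≤ G (length M * (length M + 2 * length Qs) + length (cliqueCover Qs))
  θe≤-matching M Qs edges cls cov =
    cliqueCover (map pair M ++ Qs) ,
    cliqueCover-isECC (map pair M ++ Qs) (All.++⁺ (All.map⁺ (All.map edge⇒allPairs edges)) cls) part ,
    ≤-reflexive (length-cliqueCover-matching M Qs)
    where
    part : ∀ z → Any (z ∈_) (map pair M ++ Qs)
    part z = Sum.[ Any.++⁺ˡ ∘ ∈-endpoints⁻ M , Any.++⁺ʳ (map pair M) ] (cov z)

  absorb : ∀ {p} {P : Pred (Fin n × Fin n) p} {M Q Qs} (i : Any P M) →
           CoversVertices M (Q ∷ Qs) → CoversVertices (M ─ i) ((Q ++ pair (Any.lookup i)) ∷ Qs)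
  absorb {Q = Q} i cov z with cov z
  ... | inj₂ (here z∈Q)   = inj₂ (here (∈-++⁺ˡ z∈Q))
  ... | inj₂ (there z∈Qs) = inj₂ (there z∈Qs)
  ... | inj₁ z∈M with ∈-endpoints-─ i z∈M
  ...   | inj₁ z∈e  = inj₂ (here (∈-++⁺ʳ Q z∈e))
  ...   | inj₂ z∈M′ = inj₁ z∈M′

  CoversVertices-swap : ∀ {M P Q Qs} → CoversVertices M (P ∷ Q ∷ Qs) → CoversVertices M (Q ∷ P ∷ Qs)
  CoversVertices-swap cov z with cov z
  ... | inj₁ z∈M                 = inj₁ z∈M
  ... | inj₂ (here z∈P)          = inj₂ (there (here z∈P))
  ... | inj₂ (there (here z∈Q))  = inj₂ (here z∈Q)
  ... | inj₂ (there (there z∈Qs)) = inj₂ (there (there z∈Qs))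

  θe≤-mono : ∀ {j k} → j ≤ k → θe≤ G j → θe≤ G k
  θe≤-mono j≤k (𝒞 , ecc , |𝒞|≤j) = 𝒞 , ecc , ≤-trans |𝒞|≤j j≤k

  Crosses : Fin n → Fin n → Fin n × Fin n → Set
  Crosses u w (x , y) = (Adj G u x × Adj G w y) ⊎ (Adj G u y × Adj G w x)

  crosses? : ∀ u w e → Dec (Crosses u w e)
  crosses? u w (x , y) = (adj? G u x ×-dec adj? G w y) ⊎-dec (adj? G u y ×-dec adj? G w x)

  -- Without a crossing, {ux, wy} and {uy, wx} each contain at most one edge.
  adjCount-noncrossing : ∀ u w {x y} L → ¬ Crosses u w (x , y) →
    adjCount u (x ∷ y ∷ L) + adjCount w (x ∷ y ∷ L) ≤ 2 + (adjCount u L + adjCount w L)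
  adjCount-noncrossing u w {x} {y} L ¬c = begin
    adjCount u (x ∷ y ∷ L) + adjCount w (x ∷ y ∷ L)    ≡⟨ cong₂ _+_ (count u) (count w) ⟩
    (ux + (uy + cu)) + (wx + (wy + cw))                ≡⟨ regroup ux uy wx wy cu cw ⟩
    (ux + wy) + (uy + wx) + (cu + cw)                  ≤⟨ +-monoˡ-≤ (cu + cw) (+-mono-≤
                                                            (indicator-+-≤1 (adj? G u x) (adj? G w y) (¬c ∘ inj₁))
                                                            (indicator-+-≤1 (adj? G u y) (adj? G w x) (¬c ∘ inj₂))) ⟩
    2 + (cu + cw)                                      ∎
    where
    open ≤-Reasoning
    ux = indicator (adj? G u x)
    uy = indicator (adj? G u y)
    wx = indicator (adj? G w x)
    wy = indicator (adj? G w y)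
    cu = adjCount u L
    cw = adjCount w L
    count : ∀ v → adjCount v (x ∷ y ∷ L) ≡ indicator (adj? G v x) + (indicator (adj? G v y) + adjCount v L)
    count v = trans (adjCount-∷ v x (y ∷ L)) (cong (indicator (adj? G v x) +_) (adjCount-∷ v y L))
    regroup : ∀ a b c d e f → (a + (b + e)) + (c + (d + f)) ≡ (a + d) + (b + c) + (e + f)
    regroup = solve-∀

  crossing-edge : ∀ u w M → 2 * length M < adjCount u (endpoints M) + adjCount w (endpoints M) →
                  Any (Crosses u w) M
  crossing-edge u w [] ()
  crossing-edge u w ((x , y) ∷ M) many with crosses? u w (x , y)
  ... | yes c  = here c
  ... | no ¬c  = there (crossing-edge u w M (+-cancelˡ-< 2 (2 * length M) (adjCount u E + adjCount w E)
                   (<-≤-trans (subst (_< adjCount u (x ∷ y ∷ E) + adjCount w (x ∷ y ∷ E)) (*-suc 2 (length M)) many)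
                              (adjCount-noncrossing u w E ¬c))))
    where E = endpoints M

  AdjToBoth : Fin n → Fin n × Fin n → Set
  AdjToBoth u e = All (Adj G u) (pair e)

  common-neighbour-edge : ∀ u M → length M < adjCount u (endpoints M) → Any (AdjToBoth u) M
  common-neighbour-edge u M many =
    Any.map both (crossing-edge u u M (subst (_< c + c) (cong (m +_) (≡.sym (+-identityʳ m))) (+-mono-< many many)))
    where
    m = length M
    c = adjCount u (endpoints M)
    both : ∀ {e} → Crosses u u e → AdjToBoth u e
    both (inj₁ (ux , uy)) = ux ∷ uy ∷ []
    both (inj₂ (uy , ux)) = ux ∷ uy ∷ []

  orient : ∀ {u w} e → Crosses u w e →
           ∃₂ λ a b → Adj G u a × Adj G w b × (∀ {t} → t ∈ pair e → t ∈ pair (a , b))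
  orient (x , y) (inj₁ (ux , wy)) = x , y , ux , wy , λ t∈ → t∈
  orient (x , y) (inj₂ (uy , wx)) = y , x , uy , wx , λ
    { (here refl)         → there (here refl)
    ; (there (here refl)) → here refl
    }

  record PartialMatching (X : List (Fin n)) (N j : ℕ) : Set where
    constructor partialMatching
    field
      edges      : List (Fin n × Fin n)
      unmatched  : List (Fin n)
      edges-adj  : All Edge edges
      #unmatched : length unmatched ≡ j
      size       : 2 * length edges + j ≡ N
      covers     : ∀ z → z ∈ endpoints edges ++ X ⊎ z ∈ unmatched

  nbrs-matched : ∀ {a E U} → (∀ z → z ∈ E ⊎ z ∈ U) → ¬ Any (Adj G a) U → ∀ {t} → Adj G a t → t ∈ E
  nbrs-matched cov ¬aU {t} at = Sum.[ (λ t∈E → t∈E) , (λ t∈U → ⊥-elim (¬aU (lose t∈U at))) ] (cov t)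

  module _ (X : List (Fin n)) (N : ℕ)
           (degree-sum : ∀ u w → N + 2 * length X ≤ degree G u + degree G w) where

    match : ∀ {j M u R} → All Edge M → length R ≡ suc j → 2 * length M + (2 + j) ≡ N →
            (∀ z → z ∈ endpoints M ++ X ⊎ z ∈ u ∷ R) → Any (Adj G u) R → PartialMatching X N j
    match {j} {M} {u} {R} adj len size cov i =
      partialMatching ((u , Any.lookup i) ∷ M) (R ─ i) (lookup-result i ∷ adj)
        (suc-injective (trans (≡.sym (length-removeAt′ R (Any.index i))) len))
        (trans (2*[1+m]+j≡2*m+[2+j] (length M) j) size) cover
      where
      cover : ∀ z → z ∈ u ∷ Any.lookup i ∷ endpoints M ++ X ⊎ z ∈ (R ─ i)
      cover z with cov z
      ... | inj₁ z∈ = inj₁ (there (there z∈))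
      ... | inj₂ (here refl) = inj₁ (here refl)
      ... | inj₂ (there z∈) with Any-─⁻ i z∈
      ...   | inj₁ refl = inj₁ (there (here refl))
      ...   | inj₂ z∈′  = inj₂ z∈′

    crossing-matched-edge : ∀ {j M u w U} → 2 * length M + (2 + j) ≡ N →
      (∀ z → z ∈ endpoints M ++ X ⊎ z ∈ U) → ¬ Any (Adj G u) U → ¬ Any (Adj G w) U → Any (Crosses u w) M
    crossing-matched-edge {j} {M} {u} {w} size cov ¬uU ¬wU = crossing-edge u w M (crossing-count
      (length M) j (length X) (adjCount u (endpoints M)) (adjCount w (endpoints M)) (begin
        (2 * length M + (2 + j)) + 2 * length X   ≡⟨ cong (_+ 2 * length X) size ⟩
        N + 2 * length X                          ≤⟨ degree-sum u w ⟩
        degree G u + degree G w                   ≤⟨ +-mono-≤ (degree≤ u ¬uU) (degree≤ w ¬wU) ⟩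
        (adjCount u (endpoints M) + length X) + (adjCount w (endpoints M) + length X) ∎))
      where
      open ≤-Reasoning
      degree≤ : ∀ a → ¬ Any (Adj G a) _ → degree G a ≤ adjCount a (endpoints M) + length X
      degree≤ a ¬aU = degree≤adjCount+length a (endpoints M) X (nbrs-matched cov ¬aU)

    reroute : ∀ {j M u w U} → All Edge M → length U ≡ j → 2 * length M + (2 + j) ≡ N →
              (∀ z → z ∈ endpoints M ++ X ⊎ z ∈ u ∷ w ∷ U) → Any (Crosses u w) M → PartialMatching X N j
    reroute {j} {M} {u} {w} {U} adj len size cov i with orient (Any.lookup i) (lookup-result i)
    ... | a , b , ua , wb , e⊆ab =
      partialMatching ((u , a) ∷ (w , b) ∷ (M ─ i)) U (ua ∷ wb ∷ All.─⁺ i adj) len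
        (trans (2*[1+m]+j≡2*m+[2+j] (suc (length (M ─ i))) j)
               (trans (cong (λ l → 2 * l + (2 + j)) (≡.sym (length-removeAt′ M (Any.index i)))) size))
        cover
      where
      cover : ∀ z → z ∈ u ∷ a ∷ w ∷ b ∷ endpoints (M ─ i) ++ X ⊎ z ∈ U
      cover z with cov z
      ... | inj₂ (here refl)         = inj₁ (here refl)
      ... | inj₂ (there (here refl)) = inj₁ (there (there (here refl)))
      ... | inj₂ (there (there z∈))  = inj₂ z∈
      ... | inj₁ z∈ with ∈-++⁻ (endpoints M) z∈
      ...   | inj₂ z∈X = inj₁ (there (there (there (there (∈-++⁺ʳ (endpoints (M ─ i)) z∈X)))))
      ...   | inj₁ z∈M with ∈-endpoints-─ i z∈M
      ...     | inj₂ z∈M′ = inj₁ (there (there (there (there (∈-++⁺ˡ z∈M′)))))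
      ...     | inj₁ z∈e with e⊆ab z∈e
      ...       | here refl         = inj₁ (there (here refl))
      ...       | there (here refl) = inj₁ (there (there (there (here refl))))

    augment : ∀ {j} → PartialMatching X N (2 + j) → PartialMatching X N j
    augment (partialMatching M (u ∷ w ∷ U) adj len size cov) with any? (adj? G u) (w ∷ U) | any? (adj? G w) U
    ... | yes i  | _      = match adj (suc-injective len) size cov i
    ... | no ¬uU | yes i  = match adj (suc-injective len) size (Sum.map₂ swap-front ∘ cov) (there i)
      where
      swap-front : ∀ {z} → z ∈ u ∷ w ∷ U → z ∈ w ∷ u ∷ U
      swap-front (here refl)         = there (here refl)
      swap-front (there (here refl)) = here refl
      swap-front (there (there z∈))  = there (there z∈)
    ... | no ¬uU | no ¬wU = reroute adj (suc-injective (suc-injective len)) size cov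
      (crossing-matched-edge size cov ¬u ¬w)
      where
      ¬u : ¬ Any (Adj G u) (u ∷ w ∷ U)
      ¬u (here uu)  = irrefl G u uu
      ¬u (there uU) = ¬uU uU
      ¬w : ¬ Any (Adj G w) (u ∷ w ∷ U)
      ¬w (here wu)          = ¬uU (here (sym G wu))
      ¬w (there (here ww))  = irrefl G w ww
      ¬w (there (there wU)) = ¬wU wU

    saturate : ∀ k → PartialMatching X N (k + k) → PartialMatching X N 0
    saturate zero    s = s
    saturate (suc k) s = saturate k (augment (subst (PartialMatching X N) (cong suc (+-suc k k)) s))

  perfectMatching : ∀ (X U : List (Fin n)) k → length U ≡ k + k → (∀ z → z ∈ X ⊎ z ∈ U) →
    (∀ u w → length U + 2 * length X ≤ degree G u + degree G w) →
    ∃ λ M → All Edge M × length M ≡ k × (∀ z → z ∈ endpoints M ⊎ z ∈ X)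
  perfectMatching X U k |U| cov degree-sum =
    matched (saturate X (length U) degree-sum k (partialMatching [] U [] |U| (≡.sym |U|) cov))
    where
    matched : PartialMatching X (length U) 0 → ∃ λ M → All Edge M × length M ≡ k × (∀ z → z ∈ endpoints M ⊎ z ∈ X)
    matched (partialMatching M [] adj _ size cov) =
      M , adj , *-cancelˡ-≡ (length M) k 2 (trans (≡.sym (+-identityʳ (2 * length M))) (trans size (trans |U| (double k)))) ,
      λ z → Sum.[ ∈-++⁻ (endpoints M) , (λ ()) ] (cov z)
      where
      double : ∀ k → k + k ≡ 2 * k
      double = solve-∀

  triangle : ∀ {u e} → Edge e → AdjToBoth u e → AllPairs (Adj G) (u ∷ pair e)
  triangle edge both = both ∷ edge⇒allPairs edge

  θe≤-absorb : ∀ {p} {P : Pred (Fin n × Fin n) p} {Q} M → All Edge M → CoversVertices M (Q ∷ []) →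
               (i : Any P M) → AllPairs (Adj G) (Q ++ pair (Any.lookup i)) → θe≤ G (length M * length M)
  θe≤-absorb {Q = Q} M adj cov i clique =
    θe≤-mono (≤-reflexive (begin
      m * (m + 2 * 1) + length (cliqueCover (Q′ ∷ [])) ≡⟨ cong (m * (m + 2 * 1) +_) (length-cliqueCover-singleton Q′) ⟩
      m * (m + 2 * 1) + 1                               ≡⟨ m*[m+2]+1≡[1+m]*[1+m] m ⟩
      suc m * suc m                                     ≡⟨ cong (λ l → l * l) (≡.sym |M|) ⟩
      length M * length M                               ∎))
      (θe≤-matching (M ─ i) (Q′ ∷ []) (All.─⁺ i adj) (clique ∷ []) (absorb i cov))
    where
    open ≡-Reasoning
    Q′ = Q ++ pair (Any.lookup i)
    m = length (M ─ i)
    |M| : length M ≡ suc m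
    |M| = length-removeAt′ M (Any.index i)

  θe≤-two-triangles : ∀ {x y} M → All Edge M → CoversVertices M ((x ∷ []) ∷ (y ∷ []) ∷ []) →
    (i : Any (AdjToBoth x) M) (j : Any (AdjToBoth y) M) → Any.index i ≢ Any.index j →
    θe≤ G (suc (length M * length M))
  θe≤-two-triangles M adj cov i j i≢j =
    θe≤-mono (≤-reflexive (trans (m*[m+4]+5≡1+[2+m]*[2+m] m) (cong (λ l → suc (l * l)) (≡.sym |M|))))
      (θe≤-matching ((M ─ i) ─ j′) (_ ∷ _ ∷ []) (All.─⁺ j′ (All.─⁺ i adj))
        (Product.uncurry triangle (All.lookupAny (All.─⁺ i adj) j′) ∷
         Product.uncurry triangle (All.lookupAny adj i) ∷ [])
        (absorb j′ (CoversVertices-swap {M ─ i} (absorb i cov))))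
    where
    j′ : Any (AdjToBoth _) (M ─ i)
    j′ = Any-─⁺ i j i≢j
    m = length ((M ─ i) ─ j′)
    |M| : length M ≡ suc (suc m)
    |M| = trans (length-removeAt′ M (Any.index i)) (cong suc (length-removeAt′ (M ─ i) (Any.index j′)))

  θe-odd : ∀ k → n ≡ suc (k + k) → (∀ v → suc k ≤ degree G v) → Fin n → θe≤ G (k * k)
  θe-odd k n≡ δ≤ v = coverWithTriangle (perfectMatching (v ∷ []) U k |U| cover degree-sum)
    where
    U = allFin n ─ ∈-allFin v
    |U| : length U ≡ k + k
    |U| = suc-injective (trans (≡.sym (length-removeAt′ (allFin n) (Any.index (∈-allFin v))))
                               (trans (length-tabulate _) n≡))
    cover : ∀ z → z ∈ v ∷ [] ⊎ z ∈ U
    cover z = Sum.map₁ (λ z≡ → here (trans z≡ (≡.sym (lookup-result (∈-allFin v)))))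
                       (Any-─⁻ (∈-allFin v) (∈-allFin z))
    degree-sum : ∀ u w → length U + 2 * 1 ≤ degree G u + degree G w
    degree-sum u w = ≤-trans (≤-reflexive (trans (cong (_+ 2) |U|) (k+k+2≡[1+k]+[1+k] k))) (+-mono-≤ (δ≤ u) (δ≤ w))
    coverWithTriangle : (∃ λ M → All Edge M × length M ≡ k × (∀ z → z ∈ endpoints M ⊎ z ∈ v ∷ [])) →
                        θe≤ G (k * k)
    coverWithTriangle (M , adj , |M| , cov) =
      subst (λ l → θe≤ G (l * l)) |M| (θe≤-absorb M adj (Sum.map₂ here ∘ cov) i (Product.uncurry triangle (All.lookupAny adj i)))
      where
      ¬vv : ¬ Any (Adj G v) (v ∷ [])
      ¬vv (here vv) = irrefl G v vv
      i : Any (AdjToBoth v) M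
      i = common-neighbour-edge v M (subst (_< adjCount v (endpoints M)) (≡.sym |M|)
            (≤-trans (δ≤ v) (degree≤adjCount v (endpoints M) (nbrs-matched cov ¬vv))))

  θe≤-around-edge : ∀ {x y} M → Adj G x y → All Edge M → (∀ z → z ∈ x ∷ y ∷ endpoints M) →
    Any (AdjToBoth x) M → Any (AdjToBoth y) M → θe≤ G (suc (length M * length M))
  θe≤-around-edge {x} {y} M xy adj cov iₓ iᵧ with Any.index iₓ Fin.≟ Any.index iᵧ
  ... | yes same = θe≤-mono (n≤1+n _) (θe≤-absorb M adj cov₁ iₓ ((xy ∷ xBoth) ∷ triangle edge yBoth))
    where
    edge = proj₁ (All.lookupAny adj iₓ)
    xBoth = proj₂ (All.lookupAny adj iₓ)
    yBoth = subst (AdjToBoth y ∘ List.lookup M) (≡.sym same) (lookup-result iᵧ)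
    cov₁ : CoversVertices M ((x ∷ y ∷ []) ∷ [])
    cov₁ z with cov z
    ... | here refl         = inj₂ (here (here refl))
    ... | there (here refl) = inj₂ (here (there (here refl)))
    ... | there (there z∈)  = inj₁ z∈
  ... | no differ = θe≤-two-triangles M adj cov₂ iₓ iᵧ differ
    where
    cov₂ : CoversVertices M ((x ∷ []) ∷ (y ∷ []) ∷ [])
    cov₂ z with cov z
    ... | here refl         = inj₂ (here (here refl))
    ... | there (here refl) = inj₂ (there (here (here refl)))
    ... | there (there z∈)  = inj₁ z∈

  θe-even : ∀ k → n ≡ suc k + suc k → (∀ v → 2 + k ≤ degree G v) → θe≤ G (suc (k * k))
  θe-even k n≡ δ≤ = coverAroundEdge
    (perfectMatching [] (allFin n) (suc k) |V| (λ z → inj₂ (∈-allFin z)) degree-sum)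
    where
    |V| : length (allFin n) ≡ suc k + suc k
    |V| = trans (length-tabulate _) n≡
    degree-sum : ∀ u w → length (allFin n) + 2 * 0 ≤ degree G u + degree G w
    degree-sum u w = ≤-trans (≤-reflexive (trans (+-identityʳ _) |V|))
                             (+-mono-≤ (≤-trans (n≤1+n _) (δ≤ u)) (≤-trans (n≤1+n _) (δ≤ w)))
    coverAroundEdge : (∃ λ M → All Edge M × length M ≡ suc k × (∀ z → z ∈ endpoints M ⊎ z ∈ [])) →
                      θe≤ G (suc (k * k))
    coverAroundEdge ([] , _ , () , _)
    coverAroundEdge ((x , y) ∷ M , xy ∷ adj , |xyM| , cov) =
      subst (λ l → θe≤ G (suc (l * l))) |M| (θe≤-around-edge M xy adj cov′
        (common-neighbour-edge x M (many x y x-nbrs)) (common-neighbour-edge y M (many y x y-nbrs)))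
      where
      |M| : length M ≡ k
      |M| = suc-injective |xyM|
      cov′ : ∀ z → z ∈ x ∷ y ∷ endpoints M
      cov′ z = Sum.[ (λ z∈ → z∈) , (λ ()) ] (cov z)
      -- Besides xy, each of x, y has at least k + 1 neighbours, all among the endpoints of the k edges of M.
      many : ∀ a b → (∀ {t} → Adj G a t → t ∈ endpoints M ++ b ∷ []) → length M < adjCount a (endpoints M)
      many a b nbrs = subst (_< adjCount a (endpoints M)) (≡.sym |M|)
        (+-cancelʳ-≤ 1 (suc k) (adjCount a (endpoints M))
          (≤-trans (≤-reflexive (+-comm (suc k) 1)) (≤-trans (δ≤ a) (degree≤adjCount+length a (endpoints M) (b ∷ []) nbrs))))
      x-nbrs : ∀ {t} → Adj G x t → t ∈ endpoints M ++ y ∷ []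
      x-nbrs {t} xt with cov′ t
      ... | here refl         = ⊥-elim (irrefl G x xt)
      ... | there (here refl) = ∈-++⁺ʳ (endpoints M) (here refl)
      ... | there (there t∈)  = ∈-++⁺ˡ t∈
      y-nbrs : ∀ {t} → Adj G y t → t ∈ endpoints M ++ x ∷ []
      y-nbrs {t} yt with cov′ t
      ... | here refl         = ∈-++⁺ʳ (endpoints M) (here refl)
      ... | there (here refl) = ⊥-elim (irrefl G y yt)
      ... | there (there t∈)  = ∈-++⁺ˡ t∈

odd-bound : ∀ {n} k c → n ≡ suc (k + k) → c ≤ k * k → 4 * c + 2 * n ≤ n * n + 1
odd-bound k c refl c≤ = ≤-trans (+-monoˡ-≤ _ (*-monoʳ-≤ 4 c≤)) (≤-reflexive (expand k))
  where
  expand : ∀ k → 4 * (k * k) + 2 * suc (k + k) ≡ suc (k + k) * suc (k + k) + 1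
  expand = solve-∀

even-bound : ∀ {n} k c → n ≡ suc k + suc k → c ≤ suc (k * k) → 4 * c + 4 * n ≤ n * n + 8
even-bound k c refl c≤ = ≤-trans (+-monoˡ-≤ _ (*-monoʳ-≤ 4 c≤)) (≤-reflexive (expand k))
  where
  expand : ∀ k → 4 * suc (k * k) + 4 * (suc k + suc k) ≡ (suc k + suc k) * (suc k + suc k) + 8
  expand = solve-∀

2*[1+k]≡1+[k+k]+1 : ∀ k → 2 * suc k ≡ suc (k + k) + 1
2*[1+k]≡1+[k+k]+1 = solve-∀

2*[2+k]≡[1+k]+[1+k]+2 : ∀ k → 2 * (2 + k) ≡ (suc k + suc k) + 2
2*[2+k]≡[1+k]+[1+k]+2 = solve-∀

odd-case : ∀ {n} (G : Graph n) δ → (∀ v → δ ≤ degree G v) → Fin n → 2 * δ ≡ n + 1 →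
           Σ (List (Subset n)) (λ 𝒞 → IsEdgeCliqueCover G 𝒞 × 4 * length 𝒞 + 2 * n ≤ n * n + 1)
odd-case {n} G zero    _  _ 0≡n+1   = contradiction (m+n≡0⇒n≡0 n (≡.sym 0≡n+1)) λ ()
odd-case {n} G (suc k) δ≤ v 2δ≡n+1 =
  let 𝒞 , ecc , |𝒞|≤ = θe-odd G k n≡ δ≤ v in 𝒞 , ecc , odd-bound k (length 𝒞) n≡ |𝒞|≤
  where
  n≡ : n ≡ suc (k + k)
  n≡ = +-cancelʳ-≡ 1 n (suc (k + k)) (trans (≡.sym 2δ≡n+1) (2*[1+k]≡1+[k+k]+1 k))

even-case : ∀ {n} (G : Graph n) δ → (∀ v → δ ≤ degree G v) → Fin n → 2 * δ ≡ n + 2 →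
            Σ (List (Subset n)) (λ 𝒞 → IsEdgeCliqueCover G 𝒞 × 4 * length 𝒞 + 4 * n ≤ n * n + 8)
even-case {n} G zero          _  _ 0≡n+2 = contradiction (m+n≡0⇒n≡0 n (≡.sym 0≡n+2)) λ ()
even-case {n} G (suc zero)    _  v 2≡n+2 with subst Fin (+-cancelʳ-≡ 2 n 0 (≡.sym 2≡n+2)) v
... | ()
even-case {n} G (suc (suc k)) δ≤ v 2δ≡n+2 =
  let 𝒞 , ecc , |𝒞|≤ = θe-even G k n≡ δ≤ in 𝒞 , ecc , even-bound k (length 𝒞) n≡ |𝒞|≤
  where
  n≡ : n ≡ suc k + suc k
  n≡ = +-cancelʳ-≡ 2 n (suc k + suc k) (trans (≡.sym 2δ≡n+2) (2*[2+k]≡[1+k]+[1+k]+2 k))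

mainTheorem2 : ∀ (n : ℕ) (G : Graph n) (δ : ℕ) → MinDegree G δ →
    ((2 * δ ≡ n + 1 →
        Σ (List (Subset n)) (λ 𝒞 → IsEdgeCliqueCover G 𝒞 × 4 * length 𝒞 + 2 * n ≤ n * n + 1))
    × (2 * δ ≡ n + 2 →
        Σ (List (Subset n)) (λ 𝒞 → IsEdgeCliqueCover G 𝒞 × 4 * length 𝒞 + 4 * n ≤ n * n + 8)))
mainTheorem2 n G δ (δ≤ , v , _) = odd-case G δ δ≤ v , even-case G δ δ≤ v
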